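{- For every $n\ge 2$, the minimum possible co-dimension (in $\mathbb{Z}_2^{\binom n2}$) of a linear space $\mathcal{L}$ of graphs on the vertex set $[n]$ such that $\mathcal{L}$ contains no clique is exactly $\lfloor n/2\rfloor$.
   Context: Graphs on $[n]=\{1,\dots,n\}$ are identified with their edge sets, i.e. with vectors in $\mathbb{Z}_2^{\binom n2}$ indexed by pairs of vertices; addition is symmetric difference of edge sets. A linear space of graphs is a family of graphs on $[n]$ closed under symmetric difference (a linear subspace of $\mathbb{Z}_2^{\binom n2}$). A clique here means a graph on $[n]$ whose edge set is the set of all pairs within some subset $A\subseteq[n]$ with $|A|\ge 2$. -}

module Defs where

open import Data.Nat using (ℕ; _≤_; _+_)
open import Data.Bool using (Bool; true; false; _∧_; _xor_)
open import Data.Fin using (Fin; _<?_)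
open import Data.Fin.Subset using (Subset; ∣_∣)
open import Data.Product using (_×_; _,_; Σ)
open import Data.List using (List; []; _∷_; length; map; filter; concatMap; allFin)
open import Data.Vec using (Vec; replicate; zipWith; lookup; fromList)
import Data.Vec as V
open import Relation.Binary.PropositionalEquality using (_≡_)
open import Relation.Nullary using (¬_)

-- The pairs {i,j} of vertices of [n] = Fin n, each listed once as (i , j) with i < j.
-- These index the coordinates of Z₂^(n choose 2).
Edges : (n : ℕ) → List (Fin n × Fin n)
Edges n = concatMap (λ j → map (λ i → (i , j)) (filter (λ i → i <? j) (allFin n))) (allFin n)

N : ℕ → ℕ
N n = length (Edges n)

-- A graph on [n] is a vector in Z₂^(n choose 2) (its edge-indicator vector).
-- (wrapped in a record so that n is recoverable from the type)
record Graph (n : ℕ) : Set where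
  constructor mkGraph
  field
    edges : Vec Bool (N n)

open Graph public

_⊕_ : ∀ {n} → Graph n → Graph n → Graph n
g ⊕ h = mkGraph (zipWith _xor_ (edges g) (edges h))

𝟎 : ∀ {n} → Graph n
𝟎 = mkGraph (replicate _ false)

clique : ∀ {n} → Subset n → Graph n
clique {n} A = mkGraph (V.map (λ e → lookup A (Data.Product.proj₁ e) ∧ lookup A (Data.Product.proj₂ e)) (fromList (Edges n)))

record IsLinearSpace {n : ℕ} (L : Graph n → Set) : Set where
  field
    has-zero : L 𝟎
    closed-⊕ : ∀ g h → L g → L h → L (g ⊕ h)

CliqueFree : ∀ {n} → (Graph n → Set) → Set
CliqueFree {n} L = (A : Subset n) → 2 ≤ ∣ A ∣ → ¬ L (clique A)

lincomb : ∀ {n k} → Vec (Graph n) k → Vec Bool k → Graph n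
lincomb V.[] V.[] = 𝟎
lincomb (g V.∷ gs) (true V.∷ cs) = g ⊕ lincomb gs cs
lincomb (g V.∷ gs) (false V.∷ cs) = lincomb gs cs

LinearlyIndependent : ∀ {n k} → Vec (Graph n) k → Set
LinearlyIndependent {k = k} B = (c : Vec Bool k) → lincomb B c ≡ 𝟎 → c ≡ replicate k false

IsBasis : ∀ {n k} → (Graph n → Set) → Vec (Graph n) k → Set
IsBasis {n} {k} L B =
  ((i : Fin k) → L (lookup B i)) ×
  LinearlyIndependent B ×
  ((g : Graph n) → L g → Σ (Vec Bool k) (λ c → lincomb B c ≡ g))

HasDim : ∀ {n} → (Graph n → Set) → ℕ → Set
HasDim {n} L d = Σ (Vec (Graph n) d) (IsBasis L)

HasCodim : ∀ {n} → (Graph n → Set) → ℕ → Set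
HasCodim {n} L m = Σ ℕ (λ d → HasDim L d × (d + m ≡ N n))

-- The ⌊n/2⌋ functionals "number of edges of K from 2j or from 2j+1 to later vertices"
-- cut out a clique-free space: on the clique of a vertex set x the j-th one is
-- x₂ⱼx₂ⱼ₊₁ + (x₂ⱼ + x₂ⱼ₊₁)·|x ∩ {2j+2, …}| mod 2, and all of them vanish only if |x| ≤ 1.
-- They are triangular, hence independent, so the codimension is exactly ⌊n/2⌋.
--
-- Conversely, a space of codimension m is the common kernel of m functionals fᵢ, and each
-- x ↦ fᵢ(clique x) is a quadratic polynomial on Z₂ⁿ. Hence F x = (1 + |x|) ∏ᵢ (1 + fᵢ(clique x))
-- has degree 2m + 1. If 2m + 1 < n the values of F sum to 0 (Chevalley–Warning), and since
-- F 0 = 1 there is a nonempty x of even size, i.e. a clique on ≥ 2 vertices, in the space.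

module Submission where

open import Defs
open import Algebra.Bundles using (CommutativeRing)
open import Data.Bool using (Bool; true; false; not; _∧_; _xor_; if_then_else_)
open import Data.Bool.Properties
  using ( xor-assoc; xor-comm; xor-identityʳ; xor-same; ∧-comm; ∧-zeroʳ; ∧-identityʳ
        ; ∧-distribˡ-xor; ∧-distribʳ-xor; ¬-not; not-injective; xor-∧-commutativeRing)
  renaming (_≟_ to _≟ᵇ_)
open import Data.Empty using (⊥-elim)
open import Data.Fin using (Fin; zero; suc; _<?_)
open import Data.Fin.Subset using (∣_∣)
open import Data.Fin.Subset.Properties using (anySubset?; ∣p∣≤n; ∣⊥∣≡0)
open import Data.List using (List; []; _∷_; _++_; filter; allFin; concatMap)
import Data.List as List
open import Data.List.Properties using (map-tabulate)
open import Data.Nat using (ℕ; zero; suc; _+_; _*_; _≤_; _<_; _/_; ⌊_/2⌋; z≤n; s≤s)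
open import Data.Nat.DivMod using (m/n*n≤m; m/n≡1+[m∸n]/n)
open import Data.Nat.Properties using (+-suc; +-identityʳ; _≤?_; ≰⇒>; ≤-trans; ≤-reflexive; *-monoˡ-≤)
open import Data.Product using (Σ; ∃-syntax; _×_; _,_; proj₁; proj₂; uncurry)
import Data.Product as Product
open import Data.Unit using (⊤)
open import Data.Vec using (Vec; []; _∷_; replicate; zipWith; lookup; map; tail; fromList)
open import Data.Vec.Properties
  using ( zipWith-assoc; zipWith-comm; zipWith-identityˡ; zipWith-identityʳ; ≡-dec
        ; lookup-zipWith; lookup-replicate; map-cong; map-const)
open import Function using (_∘_; const)
open import Relation.Binary.PropositionalEquality
  using (_≡_; _≢_; _≗_; refl; sym; trans; cong; cong₂; subst; module ≡-Reasoning)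
open import Relation.Nullary using (¬_; yes; no; does; ¬?; contradiction)
open import Relation.Nullary.Decidable using (_×-dec_)
open import Relation.Unary using (Pred; _⊆_; _∩_)

open CommutativeRing xor-∧-commutativeRing using (+-commutativeSemigroup)
open import Algebra.Properties.CommutativeSemigroup +-commutativeSemigroup
  using () renaming (interchange to xor-interchange)

private variable
  X Y : Set
  k m n d K : ℕ

Bits : ℕ → Set
Bits = Vec Bool

infixl 6 _+ᵥ_
_+ᵥ_ : Bits k → Bits k → Bits k
_+ᵥ_ = zipWith _xor_

0ᵥ : Bits k
0ᵥ = replicate _ false

+ᵥ-assoc : (x y z : Bits k) → (x +ᵥ y) +ᵥ z ≡ x +ᵥ (y +ᵥ z)
+ᵥ-assoc = zipWith-assoc xor-assoc

+ᵥ-comm : (x y : Bits k) → x +ᵥ y ≡ y +ᵥ x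
+ᵥ-comm = zipWith-comm xor-comm

+ᵥ-identityˡ : (x : Bits k) → 0ᵥ +ᵥ x ≡ x
+ᵥ-identityˡ = zipWith-identityˡ (λ _ → refl)

+ᵥ-identityʳ : (x : Bits k) → x +ᵥ 0ᵥ ≡ x
+ᵥ-identityʳ = zipWith-identityʳ xor-identityʳ

+ᵥ-self : (x : Bits k) → x +ᵥ x ≡ 0ᵥ
+ᵥ-self []      = refl
+ᵥ-self (a ∷ x) = cong₂ _∷_ (xor-same a) (+ᵥ-self x)

+ᵥ-interchange : (w x y z : Bits k) → (w +ᵥ x) +ᵥ (y +ᵥ z) ≡ (w +ᵥ y) +ᵥ (x +ᵥ z)
+ᵥ-interchange []      []      []      []      = refl
+ᵥ-interchange (a ∷ w) (b ∷ x) (c ∷ y) (d ∷ z) =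
  cong₂ _∷_ (xor-interchange a b c d) (+ᵥ-interchange w x y z)

-- Degree via finite differences, and the Chevalley–Warning argument

Fn : ℕ → Set
Fn k = Bits k → Bool

Δ : Bits k → Fn k → Fn k
Δ h F x = F (x +ᵥ h) xor F x

-- F is a polynomial of degree at most d over Z₂: all (d+1)-fold differences vanish.
Degree≤ : ℕ → Fn k → Set
Degree≤ zero    F = ∀ h x → Δ h F x ≡ false
Degree≤ (suc d) F = ∀ h → Degree≤ d (Δ h F)

Δ-cong : ∀ (h : Bits k) {F G} → F ≗ G → Δ h F ≗ Δ h G
Δ-cong h F≗G x = cong₂ _xor_ (F≗G _) (F≗G x)

Degree≤-cong : ∀ d {F G : Fn k} → F ≗ G → Degree≤ d F → Degree≤ d G
Degree≤-cong zero    F≗G dF h x = trans (sym (Δ-cong h F≗G x)) (dF h x)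
Degree≤-cong (suc d) F≗G dF h   = Degree≤-cong d (Δ-cong h F≗G) (dF h)

Degree≤-const : ∀ d (c : Bool) → Degree≤ {k} d (const c)
Degree≤-const zero    c h x = xor-same c
Degree≤-const (suc d) c h   = Degree≤-cong d (λ _ → sym (xor-same c)) (Degree≤-const d false)

Degree≤-xor : ∀ d {F G : Fn k} → Degree≤ d F → Degree≤ d G → Degree≤ d (λ x → F x xor G x)
Degree≤-xor zero    {F} {G} dF dG h x = begin
  (F (x +ᵥ h) xor G (x +ᵥ h)) xor (F x xor G x) ≡⟨ xor-interchange (F (x +ᵥ h)) _ _ _ ⟩
  Δ h F x xor Δ h G x                           ≡⟨ cong₂ _xor_ (dF h x) (dG h x) ⟩
  false                                         ∎
  where open ≡-Reasoning
Degree≤-xor (suc d) {F} {G} dF dG h =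
  Degree≤-cong d (λ x → xor-interchange (F (x +ᵥ h)) (F x) (G (x +ᵥ h)) (G x))
    (Degree≤-xor d (dF h) (dG h))

Δ-translate : ∀ (h j : Bits k) F → Δ j (λ x → F (x +ᵥ h)) ≗ (λ x → Δ j F (x +ᵥ h))
Δ-translate h j F x = cong (λ y → F y xor F (x +ᵥ h)) (begin
  (x +ᵥ j) +ᵥ h ≡⟨ +ᵥ-assoc x j h ⟩
  x +ᵥ (j +ᵥ h) ≡⟨ cong (x +ᵥ_) (+ᵥ-comm j h) ⟩
  x +ᵥ (h +ᵥ j) ≡⟨ +ᵥ-assoc x h j ⟨
  (x +ᵥ h) +ᵥ j ∎)
  where open ≡-Reasoning

Degree≤-translate : ∀ d (h : Bits k) {F} → Degree≤ d F → Degree≤ d (λ x → F (x +ᵥ h))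
Degree≤-translate zero    h {F} dF j x = trans (Δ-translate h j F x) (dF j (x +ᵥ h))
Degree≤-translate (suc d) h {F} dF j =
  Degree≤-cong d (sym ∘ Δ-translate h j F) (Degree≤-translate d h (dF j))

Δ-restrict : ∀ b (h : Bits k) G → Δ h (λ x → G (b ∷ x)) ≗ (λ x → Δ (false ∷ h) G (b ∷ x))
Δ-restrict b h G x = cong (λ c → G (c ∷ (x +ᵥ h)) xor G (b ∷ x)) (sym (xor-identityʳ b))

Degree≤-restrict : ∀ d b {G : Fn (suc k)} → Degree≤ d G → Degree≤ d (λ x → G (b ∷ x))
Degree≤-restrict zero    b {G} dG h x = trans (Δ-restrict b h G x) (dG (false ∷ h) (b ∷ x))
Degree≤-restrict (suc d) b {G} dG h =
  Degree≤-cong d (sym ∘ Δ-restrict b h G) (Degree≤-restrict d b (dG (false ∷ h)))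

xor-cancelʳ : ∀ a b → (a xor b) xor a ≡ b
xor-cancelʳ a b = trans (cong (_xor a) (xor-comm a b)) (trans (xor-assoc b a a)
                        (trans (cong (b xor_) (xor-same a)) (xor-identityʳ b)))

xor≡false⇒≡ : ∀ {a b} → a xor b ≡ false → a ≡ b
xor≡false⇒≡ {true}  {true}  _ = refl
xor≡false⇒≡ {false} {false} _ = refl

Degree≤0⇒const : ∀ {F : Fn k} → Degree≤ 0 F → F ≗ const (F 0ᵥ)
Degree≤0⇒const {F = F} dF x = xor≡false⇒≡ (begin
  F x xor F 0ᵥ          ≡⟨ cong (λ y → F y xor F 0ᵥ) (+ᵥ-identityˡ x) ⟨
  F (0ᵥ +ᵥ x) xor F 0ᵥ  ≡⟨ dF x 0ᵥ ⟩
  false                 ∎)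
  where open ≡-Reasoning

Degree≤-scale : ∀ d (c : Bool) {G : Fn k} → Degree≤ d G → Degree≤ d (λ x → c ∧ G x)
Degree≤-scale d true  dG = dG
Degree≤-scale d false dG = Degree≤-const d false

Δ-∧ : ∀ (h : Bits k) F G → Δ h (λ x → F x ∧ G x) ≗ (λ x → (Δ h F x ∧ G (x +ᵥ h)) xor (F x ∧ Δ h G x))
Δ-∧ h F G x = leibniz (F (x +ᵥ h)) (G (x +ᵥ h)) (F x) (G x)
  where
  leibniz : ∀ p q r s → (p ∧ q) xor (r ∧ s) ≡ ((p xor r) ∧ q) xor (r ∧ (q xor s))
  leibniz false q false s = refl
  leibniz true  q false s = refl
  leibniz true  q true  s = refl
  leibniz false q true  s = trans (cong (_xor s) (sym (xor-same q))) (xor-assoc q q s)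

Degree≤-∧ : ∀ a b {F G : Fn k} → Degree≤ a F → Degree≤ b G → Degree≤ (a + b) (λ x → F x ∧ G x)
Degree≤-∧ zero b {F} {G} dF dG =
  Degree≤-cong b (λ x → cong (_∧ G x) (sym (Degree≤0⇒const dF x))) (Degree≤-scale b (F 0ᵥ) {G} dG)
Degree≤-∧ (suc a) zero {F} {G} dF dG =
  subst (λ e → Degree≤ e (λ x → F x ∧ G x)) (sym (+-identityʳ (suc a)))
    (Degree≤-cong (suc a) (λ x → trans (∧-comm (G 0ᵥ) (F x)) (cong (F x ∧_) (sym (Degree≤0⇒const dG x))))
      (Degree≤-scale (suc a) (G 0ᵥ) {F} dF))
Degree≤-∧ (suc a) (suc b) {F} {G} dF dG h =
  Degree≤-cong (a + suc b) (sym ∘ Δ-∧ h F G)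
    (Degree≤-xor (a + suc b)
      (Degree≤-∧ a (suc b) (dF h) (Degree≤-translate (suc b) h {G} dG))
      (subst (λ e → Degree≤ e (λ x → F x ∧ Δ h G x)) (sym (+-suc a b)) (Degree≤-∧ (suc a) b {F} dF (dG h))))

cubeSum : ∀ k → Fn k → Bool
cubeSum zero    F = F []
cubeSum (suc k) F = cubeSum k (F ∘ (false ∷_)) xor cubeSum k (F ∘ (true ∷_))

cubeSum-cong : ∀ k {F G : Fn k} → F ≗ G → cubeSum k F ≡ cubeSum k G
cubeSum-cong zero    F≗G = F≗G []
cubeSum-cong (suc k) F≗G = cong₂ _xor_ (cubeSum-cong k (F≗G ∘ _)) (cubeSum-cong k (F≗G ∘ _))

cubeSum-xor : ∀ k (F G : Fn k) → cubeSum k (λ x → F x xor G x) ≡ cubeSum k F xor cubeSum k G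
cubeSum-xor zero    F G = refl
cubeSum-xor (suc k) F G =
  trans (cong₂ _xor_ (cubeSum-xor k (F ∘ (false ∷_)) (G ∘ (false ∷_)))
                     (cubeSum-xor k (F ∘ (true ∷_)) (G ∘ (true ∷_))))
        (xor-interchange (cubeSum k (F ∘ (false ∷_))) (cubeSum k (G ∘ (false ∷_))) _ _)

cubeSum-false : ∀ k → cubeSum k (const false) ≡ false
cubeSum-false zero    = refl
cubeSum-false (suc k) = cong₂ _xor_ (cubeSum-false k) (cubeSum-false k)

-- Pairing x with x + e₁ turns the cube sum of F into a cube sum of Δ e₁ F,
-- which has smaller degree.
cubeSum-Degree< : ∀ k d {F : Fn k} → Degree≤ d F → d < k → cubeSum k F ≡ false
cubeSum-Degree< (suc k) d {F} dF (s≤s d≤k) = begin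
  cubeSum k (F ∘ (false ∷_)) xor cubeSum k (F ∘ (true ∷_))
    ≡⟨ xor-comm (cubeSum k (F ∘ (false ∷_))) _ ⟩
  cubeSum k (F ∘ (true ∷_)) xor cubeSum k (F ∘ (false ∷_))
    ≡⟨ cubeSum-xor k (F ∘ (true ∷_)) (F ∘ (false ∷_)) ⟨
  cubeSum k (λ x → F (true ∷ x) xor F (false ∷ x))
    ≡⟨ cubeSum-cong k (λ x → cong (λ y → F (true ∷ y) xor F (false ∷ x)) (sym (+ᵥ-identityʳ x))) ⟩
  cubeSum k (λ x → Δ e₁ F (false ∷ x))
    ≡⟨ derivative-sum d dF d≤k ⟩
  false ∎
  where
  open ≡-Reasoning
  e₁ : Bits (suc k)
  e₁ = true ∷ 0ᵥ
  derivative-sum : ∀ d → Degree≤ d F → d ≤ k → cubeSum k (λ x → Δ e₁ F (false ∷ x)) ≡ false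
  derivative-sum zero    dF _ = trans (cubeSum-cong k (λ x → dF e₁ (false ∷ x))) (cubeSum-false k)
  derivative-sum (suc d) dF d<k = cubeSum-Degree< k d (Degree≤-restrict d false (dF e₁)) d<k

cubeSum-supported-at-0 : ∀ k {F : Fn k} → (∀ x → x ≢ 0ᵥ → F x ≡ false) → cubeSum k F ≡ F 0ᵥ
cubeSum-supported-at-0 zero    F0 = refl
cubeSum-supported-at-0 (suc k) {F} F0 = begin
  cubeSum k (F ∘ (false ∷_)) xor cubeSum k (F ∘ (true ∷_))
    ≡⟨ cong₂ _xor_ (cubeSum-supported-at-0 k (λ x x≢0 → F0 (false ∷ x) (x≢0 ∘ cong tail)))
                   (trans (cubeSum-cong k (λ x → F0 (true ∷ x) (λ ()))) (cubeSum-false k)) ⟩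
  F 0ᵥ xor false
    ≡⟨ xor-identityʳ (F 0ᵥ) ⟩
  F 0ᵥ ∎
  where open ≡-Reasoning

-- Chevalley–Warning over Z₂: the cube sum of F vanishes, so F 0 = 1 forces a
-- second point where F is 1.
nonzero-root : ∀ d {F : Fn k} → Degree≤ d F → d < k → F 0ᵥ ≡ true → ∃[ x ] x ≢ 0ᵥ × F x ≡ true
nonzero-root {k} d {F} dF d<k F0≡true
  with anySubset? (λ x → ¬? (≡-dec _≟ᵇ_ x 0ᵥ) ×-dec (F x ≟ᵇ true))
... | yes root = root
... | no  none = contradiction
  (trans (sym F0≡true) (trans (sym (cubeSum-supported-at-0 k vanishes)) (cubeSum-Degree< k d dF d<k))) λ ()
  where
  vanishes : ∀ x → x ≢ 0ᵥ → F x ≡ false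
  vanishes x x≢0 = ¬-not (λ Fx → none (x , x≢0 , Fx))

infixr 7 _*ᵥ_
_*ᵥ_ : Bool → Bits K → Bits K
t *ᵥ v = if t then v else 0ᵥ

infix 7 _·_
_·_ : Bits K → Bits K → Bool
[]       · []      = false
(c ∷ cs) · (a ∷ x) = (c ∧ a) xor (cs · x)

·-distribˡ-+ᵥ : (f x y : Bits K) → f · (x +ᵥ y) ≡ f · x xor f · y
·-distribˡ-+ᵥ []       []      []      = refl
·-distribˡ-+ᵥ (c ∷ cs) (a ∷ x) (b ∷ y) =
  trans (cong₂ _xor_ (∧-distribˡ-xor c a b) (·-distribˡ-+ᵥ cs x y)) (xor-interchange (c ∧ a) _ _ _)

·-distribʳ-+ᵥ : (f g x : Bits K) → (f +ᵥ g) · x ≡ f · x xor g · x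
·-distribʳ-+ᵥ []       []       []      = refl
·-distribʳ-+ᵥ (c ∷ cs) (d ∷ ds) (a ∷ x) =
  trans (cong₂ _xor_ (∧-distribʳ-xor a c d) (·-distribʳ-+ᵥ cs ds x)) (xor-interchange (c ∧ a) _ _ _)

·-zeroʳ : (f : Bits K) → f · 0ᵥ ≡ false
·-zeroʳ []       = refl
·-zeroʳ (c ∷ cs) = cong₂ _xor_ (∧-zeroʳ c) (·-zeroʳ cs)

·-zeroˡ : (x : Bits K) → 0ᵥ · x ≡ false
·-zeroˡ []      = refl
·-zeroˡ (a ∷ x) = ·-zeroˡ x

·-*ᵥʳ : ∀ (f : Bits K) t x → f · (t *ᵥ x) ≡ t ∧ f · x
·-*ᵥʳ f true  x = refl
·-*ᵥʳ f false x = ·-zeroʳ f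

·-*ᵥˡ : ∀ (f : Bits K) t x → (t *ᵥ f) · x ≡ t ∧ f · x
·-*ᵥˡ f true  x = refl
·-*ᵥˡ f false x = ·-zeroˡ x

annihilates : Vec (Bits K) m → Bits K → Bool
annihilates []       v = true
annihilates (f ∷ Fs) v = not (f · v) ∧ annihilates Fs v

annihilates-∷⁺ : ∀ f (Fs : Vec (Bits K) m) {v} →
  f · v ≡ false → annihilates Fs v ≡ true → annihilates (f ∷ Fs) v ≡ true
annihilates-∷⁺ f Fs f·v≡0 ann = cong₂ (λ a b → not a ∧ b) f·v≡0 ann

annihilates-∷⁻ : ∀ f (Fs : Vec (Bits K) m) {v} →
  annihilates (f ∷ Fs) v ≡ true → f · v ≡ false × annihilates Fs v ≡ true
annihilates-∷⁻ f Fs {v} ann with f · v | annihilates Fs v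
... | false | true = refl , refl

annihilates-0ᵥ : (Fs : Vec (Bits K) m) → annihilates Fs 0ᵥ ≡ true
annihilates-0ᵥ []       = refl
annihilates-0ᵥ (f ∷ Fs) = annihilates-∷⁺ f Fs (·-zeroʳ f) (annihilates-0ᵥ Fs)

annihilates-+ᵥ : (Fs : Vec (Bits K) m) {x y : Bits K} →
  annihilates Fs x ≡ true → annihilates Fs y ≡ true → annihilates Fs (x +ᵥ y) ≡ true
annihilates-+ᵥ []       _    _    = refl
annihilates-+ᵥ (f ∷ Fs) {x} {y} annx anny with annihilates-∷⁻ f Fs annx | annihilates-∷⁻ f Fs anny
... | fx , Fsx | fy , Fsy =
  annihilates-∷⁺ f Fs (trans (·-distribˡ-+ᵥ f x y) (cong₂ _xor_ fx fy)) (annihilates-+ᵥ Fs Fsx Fsy)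

annihilates-shear : ∀ (f b : Bits K) (Fs : Vec (Bits K) m) v →
  annihilates (map (λ h → h +ᵥ (h · b) *ᵥ f) Fs) v ≡ annihilates Fs (v +ᵥ (f · v) *ᵥ b)
annihilates-shear f b []       v = refl
annihilates-shear f b (h ∷ Fs) v = cong₂ (λ a c → not a ∧ c) sheared (annihilates-shear f b Fs v)
  where
  open ≡-Reasoning
  sheared : (h +ᵥ (h · b) *ᵥ f) · v ≡ h · (v +ᵥ (f · v) *ᵥ b)
  sheared = begin
    (h +ᵥ (h · b) *ᵥ f) · v       ≡⟨ ·-distribʳ-+ᵥ h _ v ⟩
    h · v xor ((h · b) *ᵥ f) · v  ≡⟨ cong (h · v xor_) (·-*ᵥˡ f (h · b) v) ⟩
    h · v xor (h · b) ∧ f · v     ≡⟨ cong (h · v xor_) (∧-comm (h · b) (f · v)) ⟩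
    h · v xor (f · v) ∧ h · b     ≡⟨ cong (h · v xor_) (·-*ᵥʳ h (f · v) b) ⟨
    h · v xor h · ((f · v) *ᵥ b)  ≡⟨ ·-distribˡ-+ᵥ h v _ ⟨
    h · (v +ᵥ (f · v) *ᵥ b)       ∎

·-+ᵥ-*ᵥ : ∀ (f v b : Bits K) t → f · (v +ᵥ t *ᵥ b) ≡ f · v xor (t ∧ f · b)
·-+ᵥ-*ᵥ f v b t = trans (·-distribˡ-+ᵥ f v (t *ᵥ b)) (cong (f · v xor_) (·-*ᵥʳ f t b))

-- The first functional f with f · b = 1 is the pivot; every later h is replaced
-- by h + (h · b) f, which vanishes at b.
eliminate : (Fs : Vec (Bits K) (suc m)) (b : Bits K) → annihilates Fs b ≡ false →
  ∃[ Fs′ ] ∀ v → annihilates {m = m} Fs′ v ≡ true → ∃[ t ] annihilates Fs (v +ᵥ t *ᵥ b) ≡ true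
eliminate (f ∷ Fs) b Fs∌b with f · b in f·b
... | true = map (λ h → h +ᵥ (h · b) *ᵥ f) Fs , λ v ann →
  f · v , annihilates-∷⁺ f Fs (pivot v) (trans (sym (annihilates-shear f b Fs v)) ann)
  where
  pivot : ∀ v → f · (v +ᵥ (f · v) *ᵥ b) ≡ false
  pivot v = begin
    f · (v +ᵥ (f · v) *ᵥ b)    ≡⟨ ·-+ᵥ-*ᵥ f v b (f · v) ⟩
    f · v xor (f · v ∧ f · b)  ≡⟨ cong (λ c → f · v xor (f · v ∧ c)) f·b ⟩
    f · v xor (f · v ∧ true)   ≡⟨ cong (f · v xor_) (∧-identityʳ (f · v)) ⟩
    f · v xor f · v            ≡⟨ xor-same (f · v) ⟩
    false                      ∎
    where open ≡-Reasoning
eliminate {m = zero}  (f ∷ []) b ()   | false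
eliminate {m = suc m} (f ∷ Fs) b Fs∌b | false with eliminate Fs b Fs∌b
... | Fs′ , lift = f ∷ Fs′ , λ v ann →
  let (f·v , Fs′v) = annihilates-∷⁻ f Fs′ ann ; (t , Fs-v+tb) = lift v Fs′v
  in t , annihilates-∷⁺ f Fs (skip v t f·v) Fs-v+tb
  where
  skip : ∀ v t → f · v ≡ false → f · (v +ᵥ t *ᵥ b) ≡ false
  skip v t f·v = trans (·-+ᵥ-*ᵥ f v b t) (trans (cong₂ (λ p c → p xor (t ∧ c)) f·v f·b) (∧-zeroʳ t))

standardBasis : ∀ K → Vec (Bits K) K
standardBasis zero    = []
standardBasis (suc K) = (true ∷ 0ᵥ) ∷ map (false ∷_) (standardBasis K)

annihilates-standardBasis : ∀ K {x : Bits K} → annihilates (standardBasis K) x ≡ true → x ≡ 0ᵥ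
annihilates-standardBasis zero    {[]}    _   = refl
annihilates-standardBasis (suc K) {a ∷ x} ann
  with annihilates-∷⁻ (true ∷ 0ᵥ) (map (false ∷_) (standardBasis K)) ann
... | a·0 , rest = cong₂ _∷_ (trans (sym (xor-identityʳ a)) (trans (cong (a xor_) (sym (·-zeroˡ x))) a·0))
                             (annihilates-standardBasis K (trans (sym (drop-head (standardBasis K))) rest))
  where
  drop-head : (Fs : Vec (Bits K) m) → annihilates (map (false ∷_) Fs) (a ∷ x) ≡ annihilates Fs x
  drop-head []       = refl
  drop-head (h ∷ Fs) = cong (not (h · x) ∧_) (drop-head Fs)

combine : Vec (Bits K) k → Bits k → Bits K
combine []       []          = 0ᵥ
combine (v ∷ vs) (true  ∷ c) = v +ᵥ combine vs c
combine (v ∷ vs) (false ∷ c) = combine vs c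

combine-map-false∷ : (vs : Vec (Bits K) k) (c : Bits k) →
                     combine (map (false ∷_) vs) c ≡ false ∷ combine vs c
combine-map-false∷ []       []          = refl
combine-map-false∷ (v ∷ vs) (true  ∷ c) = cong ((false ∷ v) +ᵥ_) (combine-map-false∷ vs c)
combine-map-false∷ (v ∷ vs) (false ∷ c) = combine-map-false∷ vs c

combine-standardBasis : ∀ K (c : Bits K) → combine (standardBasis K) c ≡ c
combine-standardBasis zero    []          = refl
combine-standardBasis (suc K) (true  ∷ c) =
  trans (cong ((true ∷ 0ᵥ) +ᵥ_) (combine-map-false∷ (standardBasis K) c))
        (cong (true ∷_) (trans (+ᵥ-identityˡ _) (combine-standardBasis K c)))
combine-standardBasis (suc K) (false ∷ c) =
  trans (combine-map-false∷ (standardBasis K) c) (cong (false ∷_) (combine-standardBasis K c))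

Triangular : {X : Set} → (X → Bits K) → Vec (Bits K) m → Set
Triangular ι []       = ⊤
Triangular ι (f ∷ Fs) = (∃[ a ] annihilates Fs (ι a) ≡ true × f · ι a ≡ true) × Triangular ι Fs

-- Linear algebra of graphs

module _ {n : ℕ} where

  infixr 25 _⊙_
  _⊙_ : Bool → Graph n → Graph n
  t ⊙ g = mkGraph (t *ᵥ edges g)

  ⊕-assoc : (x y z : Graph n) → (x ⊕ y) ⊕ z ≡ x ⊕ (y ⊕ z)
  ⊕-assoc x y z = cong mkGraph (+ᵥ-assoc (edges x) (edges y) (edges z))

  ⊕-comm : (x y : Graph n) → x ⊕ y ≡ y ⊕ x
  ⊕-comm x y = cong mkGraph (+ᵥ-comm (edges x) (edges y))

  ⊕-identityˡ : (x : Graph n) → 𝟎 ⊕ x ≡ x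
  ⊕-identityˡ x = cong mkGraph (+ᵥ-identityˡ (edges x))

  ⊕-identityʳ : (x : Graph n) → x ⊕ 𝟎 ≡ x
  ⊕-identityʳ x = cong mkGraph (+ᵥ-identityʳ (edges x))

  ⊕-cancelˡ : (x y : Graph n) → x ⊕ (x ⊕ y) ≡ y
  ⊕-cancelˡ x y = begin
    x ⊕ (x ⊕ y) ≡⟨ ⊕-assoc x x y ⟨
    (x ⊕ x) ⊕ y ≡⟨ cong (λ z → mkGraph z ⊕ y) (+ᵥ-self (edges x)) ⟩
    𝟎 ⊕ y       ≡⟨ ⊕-identityˡ y ⟩
    y           ∎
    where open ≡-Reasoning

  ⊙-distrib-xor : ∀ s t (b : Graph n) → (s xor t) ⊙ b ≡ s ⊙ b ⊕ t ⊙ b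
  ⊙-distrib-xor true  true  b = sym (cong mkGraph (+ᵥ-self (edges b)))
  ⊙-distrib-xor true  false b = sym (⊕-identityʳ b)
  ⊙-distrib-xor false t     b = sym (⊕-identityˡ (t ⊙ b))

  ·-⊙ : ∀ f t (b : Graph n) → f · edges (t ⊙ b) ≡ t ∧ f · edges b
  ·-⊙ f t b = ·-*ᵥʳ f t (edges b)

  Span : Vec (Graph n) d → Pred (Graph n) _
  Span B g = ∃[ c ] lincomb B c ≡ g

  Ker : Bits (N n) → Pred (Graph n) _
  Ker f g = f · edges g ≡ false

  Ann : Vec (Bits (N n)) m → Pred (Graph n) _
  Ann Fs g = annihilates Fs (edges g) ≡ true

  IsBasisOf : Pred (Graph n) _ → Vec (Graph n) d → Set
  IsBasisOf V B = LinearlyIndependent B × Span B ⊆ V × V ⊆ Span B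

  lincomb-∷ : ∀ b (B : Vec (Graph n) d) t c → lincomb (b ∷ B) (t ∷ c) ≡ t ⊙ b ⊕ lincomb B c
  lincomb-∷ b B true  c = refl
  lincomb-∷ b B false c = sym (⊕-identityˡ (lincomb B c))

  lincomb-replicate-false : (B : Vec (Graph n) d) → lincomb B (replicate d false) ≡ 𝟎
  lincomb-replicate-false []      = refl
  lincomb-replicate-false (b ∷ B) = lincomb-replicate-false B

  lincomb-mkGraph : (vs : Vec (Bits (N n)) d) (c : Bits d) →
                    lincomb (map (mkGraph {n}) vs) c ≡ mkGraph (combine vs c)
  lincomb-mkGraph []       []          = refl
  lincomb-mkGraph (v ∷ vs) (true  ∷ c) = cong (mkGraph {n} v ⊕_) (lincomb-mkGraph vs c)
  lincomb-mkGraph (v ∷ vs) (false ∷ c) = lincomb-mkGraph vs c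

  lincomb-map-hom : (φ : Graph n → Graph n) → φ 𝟎 ≡ 𝟎 → (∀ x y → φ (x ⊕ y) ≡ φ x ⊕ φ y) →
                    (B : Vec (Graph n) d) (c : Bits d) → lincomb (map φ B) c ≡ φ (lincomb B c)
  lincomb-map-hom φ φ𝟎 φ⊕ []      []          = sym φ𝟎
  lincomb-map-hom φ φ𝟎 φ⊕ (b ∷ B) (true  ∷ c) =
    trans (cong (φ b ⊕_) (lincomb-map-hom φ φ𝟎 φ⊕ B c)) (sym (φ⊕ b (lincomb B c)))
  lincomb-map-hom φ φ𝟎 φ⊕ (b ∷ B) (false ∷ c) = lincomb-map-hom φ φ𝟎 φ⊕ B c

  lookup∈Span : (B : Vec (Graph n) d) (i : Fin d) → Span B (lookup B i)
  lookup∈Span (b ∷ B) zero    =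
    true ∷ replicate _ false , trans (cong (b ⊕_) (lincomb-replicate-false B)) (⊕-identityʳ b)
  lookup∈Span (b ∷ B) (suc i) = let (c , e) = lookup∈Span B i in false ∷ c , e

  lincomb∈ : ∀ {L} → IsLinearSpace L → (B : Vec (Graph n) d) → (∀ i → L (lookup B i)) →
             ∀ c → L (lincomb B c)
  lincomb∈ L-lin []      B⊆L []          = IsLinearSpace.has-zero L-lin
  lincomb∈ L-lin (b ∷ B) B⊆L (true  ∷ c) =
    IsLinearSpace.closed-⊕ L-lin b _ (B⊆L zero) (lincomb∈ L-lin B (B⊆L ∘ suc) c)
  lincomb∈ L-lin (b ∷ B) B⊆L (false ∷ c) = lincomb∈ L-lin B (B⊆L ∘ suc) c

  LinearlyIndependent-tail : ∀ {b} {B : Vec (Graph n) d} →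
                             LinearlyIndependent (b ∷ B) → LinearlyIndependent B
  LinearlyIndependent-tail ind c e = cong tail (ind (false ∷ c) e)

  head∉Span : ∀ {b} {B : Vec (Graph n) d} → LinearlyIndependent (b ∷ B) → ¬ Span B b
  head∉Span {b = b} ind (c , e)
    with ind (true ∷ c) (trans (cong (b ⊕_) e) (cong mkGraph (+ᵥ-self (edges b))))
  ... | ()

  -- Independence keeps b out of the span of B, so not every functional obtained for B
  -- vanishes at b, and one of them can be eliminated with b as pivot.
  Ann⊆Span : (B : Vec (Graph n) d) → LinearlyIndependent B → N n ≡ d + m →
             Σ (Vec (Bits (N n)) m) λ Fs → Ann Fs ⊆ Span B
  Ann⊆Span [] _ refl =
    standardBasis (N n) , λ ann → [] , cong mkGraph (sym (annihilates-standardBasis (N n) ann))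
  Ann⊆Span {suc d} {m} (b ∷ B) ind eq
    with Ann⊆Span B (LinearlyIndependent-tail ind) (trans eq (sym (+-suc d m)))
  ... | Fs , Ann⊆B with annihilates Fs (edges b) in Fs-b
  ...   | true  = ⊥-elim (head∉Span ind (Ann⊆B Fs-b))
  ...   | false = let (Fs′ , lift) = eliminate Fs (edges b) Fs-b in Fs′ , λ {g} ann →
    let (t , ann′) = lift (edges g) ann ; (c , e) = Ann⊆B {g ⊕ t ⊙ b} ann′ in
    t ∷ c , (begin
      lincomb (b ∷ B) (t ∷ c) ≡⟨ lincomb-∷ b B t c ⟩
      t ⊙ b ⊕ lincomb B c     ≡⟨ cong (t ⊙ b ⊕_) (trans e (⊕-comm g (t ⊙ b))) ⟩
      t ⊙ b ⊕ (t ⊙ b ⊕ g)     ≡⟨ ⊕-cancelˡ (t ⊙ b) g ⟩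
      g                       ∎)
    where open ≡-Reasoning

  ⊕-interchange : (w x y z : Graph n) → (w ⊕ x) ⊕ (y ⊕ z) ≡ (w ⊕ y) ⊕ (x ⊕ z)
  ⊕-interchange w x y z = cong mkGraph (+ᵥ-interchange (edges w) (edges x) (edges y) (edges z))

  lincomb-∷-cong : ∀ {b s} {B : Vec (Graph n) d} {B′ : Vec (Graph n) k} {c c′} →
                   lincomb B c ≡ lincomb B′ c′ → lincomb (b ∷ B) (s ∷ c) ≡ lincomb (b ∷ B′) (s ∷ c′)
  lincomb-∷-cong {b = b} {s = true}  e = cong (b ⊕_) e
  lincomb-∷-cong         {s = false} e = e

  ·-lincomb-∷ : ∀ f b (B : Vec (Graph n) d) t c →
                f · edges (lincomb (b ∷ B) (t ∷ c)) ≡ (t ∧ f · edges b) xor f · edges (lincomb B c)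
  ·-lincomb-∷ f b B t c = begin
    f · edges (lincomb (b ∷ B) (t ∷ c))       ≡⟨ cong (λ g → f · edges g) (lincomb-∷ b B t c) ⟩
    f · edges (t ⊙ b ⊕ lincomb B c)           ≡⟨ ·-distribˡ-+ᵥ f (edges (t ⊙ b)) _ ⟩
    f · edges (t ⊙ b) xor f · edges (lincomb B c) ≡⟨ cong (_xor _) (·-⊙ f t b) ⟩
    (t ∧ f · edges b) xor f · edges (lincomb B c) ∎
    where open ≡-Reasoning

  -- Projection onto the hyperplane Ker f along b, when f · b = 1.
  shear : Bits (N n) → Graph n → Graph n → Graph n
  shear f b v = v ⊕ (f · edges v) ⊙ b

  lincomb-map-shear : ∀ f b (B : Vec (Graph n) d) c →
    lincomb (map (shear f b) B) c ≡ lincomb (b ∷ B) (f · edges (lincomb B c) ∷ c)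
  lincomb-map-shear f b B c = begin
    lincomb (map (shear f b) B) c ≡⟨ lincomb-map-hom (shear f b) shear-𝟎 shear-⊕ B c ⟩
    w ⊕ (f · edges w) ⊙ b         ≡⟨ ⊕-comm w _ ⟩
    (f · edges w) ⊙ b ⊕ w         ≡⟨ lincomb-∷ b B _ c ⟨
    lincomb (b ∷ B) (f · edges w ∷ c) ∎
    where
    open ≡-Reasoning
    w : Graph n
    w = lincomb B c
    shear-𝟎 : shear f b 𝟎 ≡ 𝟎
    shear-𝟎 = trans (cong (λ t → 𝟎 ⊕ t ⊙ b) (·-zeroʳ f)) (⊕-identityˡ 𝟎)
    shear-⊕ : ∀ x y → shear f b (x ⊕ y) ≡ shear f b x ⊕ shear f b y
    shear-⊕ x y = begin
      (x ⊕ y) ⊕ (f · edges (x ⊕ y)) ⊙ b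
        ≡⟨ cong (λ t → (x ⊕ y) ⊕ t ⊙ b) (·-distribˡ-+ᵥ f (edges x) (edges y)) ⟩
      (x ⊕ y) ⊕ (f · edges x xor f · edges y) ⊙ b
        ≡⟨ cong ((x ⊕ y) ⊕_) (⊙-distrib-xor _ _ b) ⟩
      (x ⊕ y) ⊕ ((f · edges x) ⊙ b ⊕ (f · edges y) ⊙ b)
        ≡⟨ ⊕-interchange x y _ _ ⟩
      shear f b x ⊕ shear f b y
        ∎

  ·-lincomb-pivot : ∀ f b (B : Vec (Graph n) d) t c → f · edges b ≡ true →
                    f · edges (lincomb (b ∷ B) (t ∷ c)) ≡ t xor f · edges (lincomb B c)
  ·-lincomb-pivot f b B t c f·b =
    trans (·-lincomb-∷ f b B t c) (cong (_xor _) (trans (cong (t ∧_) f·b) (∧-identityʳ t)))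

  pivot-basis : ∀ f {b} (B : Vec (Graph n) d) → LinearlyIndependent (b ∷ B) → f · edges b ≡ true →
                IsBasisOf (Span (b ∷ B) ∩ Ker f) (map (shear f b) B)
  pivot-basis f {b} B ind f·b = independent , sub , sup
    where
    independent : LinearlyIndependent (map (shear f b) B)
    independent c e =
      cong tail (ind (f · edges (lincomb B c) ∷ c) (trans (sym (lincomb-map-shear f b B c)) e))
    sub : Span (map (shear f b) B) ⊆ Span (b ∷ B) ∩ Ker f
    sub (c , refl) = (s ∷ c , sym (lincomb-map-shear f b B c))
                   , trans (cong (λ g → f · edges g) (lincomb-map-shear f b B c))
                           (trans (·-lincomb-pivot f b B s c f·b) (xor-same s))
      where s = f · edges (lincomb B c)
    sup : Span (b ∷ B) ∩ Ker f ⊆ Span (map (shear f b) B)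
    sup ((t ∷ c , refl) , g∈Ker) =
      c , trans (lincomb-map-shear f b B c) (cong (λ s → lincomb (b ∷ B) (s ∷ c)) (sym t≡))
      where
      t≡ : t ≡ f · edges (lincomb B c)
      t≡ = xor≡false⇒≡ (trans (sym (·-lincomb-pivot f b B t c f·b)) g∈Ker)

  ·-lincomb-skip : ∀ f b (B : Vec (Graph n) d) t c → f · edges b ≡ false →
                   f · edges (lincomb (b ∷ B) (t ∷ c)) ≡ f · edges (lincomb B c)
  ·-lincomb-skip f b B t c f·b =
    trans (·-lincomb-∷ f b B t c) (cong (_xor _) (trans (cong (t ∧_) f·b) (∧-zeroʳ t)))

  prepend-basis : ∀ f {b} {B : Vec (Graph n) d} {B′ : Vec (Graph n) k} →
                  LinearlyIndependent (b ∷ B) → f · edges b ≡ false →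
                  IsBasisOf (Span B ∩ Ker f) B′ → IsBasisOf (Span (b ∷ B) ∩ Ker f) (b ∷ B′)
  prepend-basis f {b} {B} {B′} ind f·b (ind′ , sub′ , sup′) = independent , sub , sup
    where
    independent : LinearlyIndependent (b ∷ B′)
    independent (s ∷ c) e with sub′ (c , refl)
    ... | (c′ , e′) , _ with ind (s ∷ c′) (trans (lincomb-∷-cong {b = b} {s = s} e′) e)
    ... | refl = cong (false ∷_) (ind′ c (trans (sym e′) (lincomb-replicate-false B)))
    sub : Span (b ∷ B′) ⊆ Span (b ∷ B) ∩ Ker f
    sub (s ∷ c , refl) with sub′ (c , refl)
    ... | (c′ , e′) , c∈Ker =
      (s ∷ c′ , lincomb-∷-cong {s = s} e′) , trans (·-lincomb-skip f b B′ s c f·b) c∈Ker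
    sup : Span (b ∷ B) ∩ Ker f ⊆ Span (b ∷ B′)
    sup ((t ∷ c , refl) , g∈Ker) with sup′ ((c , refl) , trans (sym (·-lincomb-skip f b B t c f·b)) g∈Ker)
    ... | c″ , e″ = t ∷ c″ , lincomb-∷-cong {s = t} e″

  hyperplane-basis : (B : Vec (Graph n) (suc d)) → LinearlyIndependent B → ∀ f {v} →
                     Span B v → f · edges v ≡ true → Σ (Vec (Graph n) d) (IsBasisOf (Span B ∩ Ker f))
  hyperplane-basis (b ∷ B) ind f (t ∷ c , refl) f·v with f · edges b in f·b
  ... | true = map (shear f b) B , pivot-basis f B ind f·b
  hyperplane-basis (b ∷ []) ind f (t ∷ [] , refl) f·v | false
    with () ← trans (sym f·v) (trans (·-lincomb-skip f b [] t [] f·b) (·-zeroʳ f))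
  hyperplane-basis {suc d} (b ∷ B) ind f (t ∷ c , refl) f·v | false =
    let (B′ , basis) = hyperplane-basis B (LinearlyIndependent-tail ind) f (c , refl)
                         (trans (sym (·-lincomb-skip f b B t c f·b)) f·v)
    in b ∷ B′ , prepend-basis f ind f·b basis

  Ann-∷⁺ : ∀ f (Fs : Vec (Bits (N n)) m) → Ann Fs ∩ Ker f ⊆ Ann (f ∷ Fs)
  Ann-∷⁺ f Fs (g∈Ann , g∈Ker) = annihilates-∷⁺ f Fs g∈Ker g∈Ann

  Ann-∷⁻ : ∀ f (Fs : Vec (Bits (N n)) m) → Ann (f ∷ Fs) ⊆ Ann Fs ∩ Ker f
  Ann-∷⁻ f Fs g∈Ann = let (g∈Ker , g∈Ann′) = annihilates-∷⁻ f Fs g∈Ann in g∈Ann′ , g∈Ker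

  standard-basis : IsBasisOf (Ann []) (map mkGraph (standardBasis (N n)))
  standard-basis = independent , (λ _ → refl) , λ {g} _ → edges g , spans (edges g)
    where
    spans : ∀ c → lincomb (map mkGraph (standardBasis (N n))) c ≡ mkGraph c
    spans c = trans (lincomb-mkGraph (standardBasis (N n)) c) (cong mkGraph (combine-standardBasis (N n) c))
    independent : LinearlyIndependent (map mkGraph (standardBasis (N n)))
    independent c e = cong edges (trans (sym (spans c)) e)

  kernel-basis : ∀ {X : Set} {ι : X → Bits (N n)} (Fs : Vec (Bits (N n)) m) → Triangular ι Fs →
                 Σ ℕ λ d → d + m ≡ N n × Σ (Vec (Graph n) d) (IsBasisOf (Ann Fs))
  kernel-basis [] _ = N n , +-identityʳ (N n) , map mkGraph (standardBasis (N n)) , standard-basis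
  kernel-basis {suc m} {ι = ι} (f ∷ Fs) ((a , a∈Ann , f·a) , tri) with kernel-basis Fs tri
  ... | zero , _ , [] , _ , _ , sup
    with [] , 𝟎≡a ← sup {mkGraph (ι a)} a∈Ann
    with () ← trans (sym f·a) (trans (cong (λ g → f · edges g) (sym 𝟎≡a)) (·-zeroʳ f))
  ... | suc d , eq , B , ind , sub , sup with hyperplane-basis B ind f (sup {mkGraph (ι a)} a∈Ann) f·a
  ...   | B′ , ind′ , sub′ , sup′ =
    d , trans (+-suc d m) eq , B′ , ind′ ,
    (λ g∈B′ → let (g∈B , g∈Ker) = sub′ g∈B′ in Ann-∷⁺ f Fs (sub g∈B , g∈Ker)) ,
    (λ g∈Ann → let (g∈Ann′ , g∈Ker) = Ann-∷⁻ f Fs g∈Ann in sup′ (sup g∈Ann′ , g∈Ker))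

-- Lower bound

Degree≤1-intro : ∀ (F : Fn k) (c : Bits k → Bool) → (∀ h x → Δ h F x ≡ c h) → Degree≤ 1 F
Degree≤1-intro F c ΔF≡c h = Degree≤-cong 0 (sym ∘ ΔF≡c h) (Degree≤-const 0 (c h))

Degree≤-lookup : (i : Fin k) → Degree≤ 1 (λ x → lookup x i)
Degree≤-lookup i = Degree≤1-intro (λ x → lookup x i) (λ h → lookup h i) λ h x →
  trans (cong (_xor lookup x i) (lookup-zipWith _xor_ i x h)) (xor-cancelʳ (lookup x i) (lookup h i))

parity : Bits k → Bool
parity []      = false
parity (b ∷ x) = b xor parity x

parity-+ᵥ : (x h : Bits k) → parity (x +ᵥ h) ≡ parity x xor parity h
parity-+ᵥ []      []      = refl
parity-+ᵥ (a ∷ x) (b ∷ h) =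
  trans (cong ((a xor b) xor_) (parity-+ᵥ x h)) (xor-interchange a b (parity x) (parity h))

Degree≤-parity : Degree≤ {k} 1 parity
Degree≤-parity = Degree≤1-intro parity parity λ h x →
  trans (cong (_xor parity x) (parity-+ᵥ x h)) (xor-cancelʳ (parity x) (parity h))

parity-0ᵥ : parity (0ᵥ {k}) ≡ false
parity-0ᵥ {zero}  = refl
parity-0ᵥ {suc k} = parity-0ᵥ {k}

weight≤0⇒0ᵥ : (x : Bits k) → ∣ x ∣ ≤ 0 → x ≡ 0ᵥ
weight≤0⇒0ᵥ []          _ = refl
weight≤0⇒0ᵥ (false ∷ x) w = cong (false ∷_) (weight≤0⇒0ᵥ x w)
weight≤0⇒0ᵥ (true  ∷ x) ()

even-weight≤1⇒0ᵥ : (x : Bits k) → ∣ x ∣ ≤ 1 → parity x ≡ false → x ≡ 0ᵥ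
even-weight≤1⇒0ᵥ []          _       _    = refl
even-weight≤1⇒0ᵥ (false ∷ x) w       even = cong (false ∷_) (even-weight≤1⇒0ᵥ x w even)
even-weight≤1⇒0ᵥ {suc k} (true  ∷ x) (s≤s w) even
  with () ← trans (sym even) (trans (cong (not ∘ parity) (weight≤0⇒0ᵥ x w)) (cong not (parity-0ᵥ {k})))

Degree≤-pairProducts : ∀ {K} (E : Vec (Fin k × Fin k) K) (f : Bits K) →
  Degree≤ 2 (λ x → f · map (λ e → lookup x (proj₁ e) ∧ lookup x (proj₂ e)) E)
Degree≤-pairProducts []            []      = Degree≤-const 2 false
Degree≤-pairProducts ((i , j) ∷ E) (a ∷ f) =
  Degree≤-xor 2 {λ x → a ∧ (lookup x i ∧ lookup x j)}
    (Degree≤-scale 2 a (Degree≤-∧ 1 1 {λ x → lookup x i} {λ x → lookup x j}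
                                  (Degree≤-lookup i) (Degree≤-lookup j)))
    (Degree≤-pairProducts E f)

Degree≤-annihilates-clique : (Fs : Vec (Bits (N n)) m) →
                             Degree≤ (m * 2) (λ x → annihilates Fs (edges (clique {n} x)))
Degree≤-annihilates-clique []                 = Degree≤-const 0 true
Degree≤-annihilates-clique {n} {suc m} (f ∷ Fs) =
  Degree≤-∧ 2 (m * 2) {λ x → not (f · edges (clique x))}
    (Degree≤-xor 2 {const true} {λ x → f · edges (clique x)}
                   (Degree≤-const 2 true) (Degree≤-pairProducts (fromList (Edges n)) f))
    (Degree≤-annihilates-clique Fs)

edges-clique-0ᵥ : edges (clique {n} 0ᵥ) ≡ 0ᵥ
edges-clique-0ᵥ {n} =
  trans (map-cong (λ e → cong (_∧ lookup 0ᵥ (proj₂ e)) (lookup-replicate (proj₁ e) false))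
                  (fromList (Edges n)))
        (map-const (fromList (Edges n)) false)

even-nonzero⇒2≤weight : (x : Bits k) → parity x ≡ false → x ≢ 0ᵥ → 2 ≤ ∣ x ∣
even-nonzero⇒2≤weight x even x≢0 with 2 ≤? ∣ x ∣
... | yes 2≤∣x∣ = 2≤∣x∣
... | no  2≰∣x∣ with s≤s ∣x∣≤1 ← ≰⇒> 2≰∣x∣ = contradiction (even-weight≤1⇒0ᵥ x ∣x∣≤1 even) x≢0

Span⊆ : ∀ {L} → IsLinearSpace L → (B : Vec (Graph n) k) → (∀ i → L (lookup B i)) → Span B ⊆ L
Span⊆ L-lin B B⊆L (c , refl) = lincomb∈ L-lin B B⊆L c

∧-≡true⁻ : ∀ {a b} → a ∧ b ≡ true → a ≡ true × b ≡ true
∧-≡true⁻ {true} {true} _ = refl , refl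

-- F x = [x has even size] · [clique x ∈ Ann Fs] has degree 2m + 1 < n and F 0 = 1,
-- so the Chevalley–Warning argument yields a nonempty even x with F x = 1.
Ann-clique : (Fs : Vec (Bits (N n)) m) → suc m * 2 ≤ n → ∃[ x ] 2 ≤ ∣ x ∣ × Ann Fs (clique x)
Ann-clique {n} {m} Fs 2m+2≤n with nonzero-root (suc (m * 2)) {F} deg-F 2m+2≤n F0
  where
  F : Fn n
  F x = not (parity x) ∧ annihilates Fs (edges (clique x))
  deg-F : Degree≤ (suc (m * 2)) F
  deg-F = Degree≤-∧ 1 (m * 2) {not ∘ parity}
            (Degree≤-xor 1 {const true} {parity} (Degree≤-const 1 true) Degree≤-parity)
            (Degree≤-annihilates-clique Fs)
  F0 : F 0ᵥ ≡ true
  F0 = cong₂ (λ p a → not p ∧ a) (parity-0ᵥ {n})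
             (trans (cong (annihilates Fs) edges-clique-0ᵥ) (annihilates-0ᵥ Fs))
... | x , x≢0 , Fx with ∧-≡true⁻ Fx
...   | even , x∈Ann = x , even-nonzero⇒2≤weight x (not-injective even) x≢0 , x∈Ann

codim-lower-bound : (L : Graph n → Set) → IsLinearSpace L → CliqueFree L → ∀ m → HasCodim L m → n / 2 ≤ m
codim-lower-bound {n} L L-lin L-cf m (d , (B , B⊆L , ind , _) , d+m≡N) with n / 2 ≤? m
... | yes n/2≤m = n/2≤m
... | no  n/2≰m =
  let (Fs , Ann⊆B) = Ann⊆Span B ind (sym d+m≡N)
      (x , 2≤∣x∣ , x∈Ann) = Ann-clique Fs (≤-trans (*-monoˡ-≤ 2 (≰⇒> n/2≰m)) (m/n*n≤m n 2))
  in ⊥-elim (L-cf x 2≤∣x∣ (Span⊆ L-lin B B⊆L (Ann⊆B x∈Ann)))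

-- Upper bound

sumOver : List X → (X → Bool) → Bool
sumOver []       f = false
sumOver (a ∷ as) f = f a xor sumOver as f

sumOver-cong : ∀ (as : List X) {f g} → f ≗ g → sumOver as f ≡ sumOver as g
sumOver-cong []       f≗g = refl
sumOver-cong (a ∷ as) f≗g = cong₂ _xor_ (f≗g a) (sumOver-cong as f≗g)

sumOver-map : ∀ (g : X → Y) as f → sumOver (List.map g as) f ≡ sumOver as (f ∘ g)
sumOver-map g []       f = refl
sumOver-map g (a ∷ as) f = cong (f (g a) xor_) (sumOver-map g as f)

sumOver-++ : ∀ (as bs : List X) f → sumOver (as ++ bs) f ≡ sumOver as f xor sumOver bs f
sumOver-++ []       bs f = refl
sumOver-++ (a ∷ as) bs f = trans (cong (f a xor_) (sumOver-++ as bs f)) (sym (xor-assoc (f a) _ _))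

sumOver-concatMap : ∀ (F : X → List Y) as f →
                    sumOver (concatMap F as) f ≡ sumOver as (λ a → sumOver (F a) f)
sumOver-concatMap F []       f = refl
sumOver-concatMap F (a ∷ as) f =
  trans (sumOver-++ (F a) (concatMap F as) f) (cong (sumOver (F a) f xor_) (sumOver-concatMap F as f))

sumOver-xor : ∀ (as : List X) f g → sumOver as (λ a → f a xor g a) ≡ sumOver as f xor sumOver as g
sumOver-xor []       f g = refl
sumOver-xor (a ∷ as) f g =
  trans (cong ((f a xor g a) xor_) (sumOver-xor as f g)) (xor-interchange (f a) (g a) _ _)

sumOver-false : ∀ (as : List X) → sumOver as (const false) ≡ false
sumOver-false []       = refl
sumOver-false (a ∷ as) = sumOver-false as

sumOver-∧ : ∀ (as : List X) c f → sumOver as (λ a → c ∧ f a) ≡ c ∧ sumOver as f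
sumOver-∧ as true  f = refl
sumOver-∧ as false f = sumOver-false as

sumOver-lookup : (x : Bits k) → sumOver (allFin k) (lookup x) ≡ parity x
sumOver-lookup []      = refl
sumOver-lookup {suc k} (a ∷ x) =
  cong (a xor_) (trans (cong (λ is → sumOver is (lookup (a ∷ x))) (sym (map-tabulate (λ i → i) suc)))
                       (trans (sumOver-map suc (allFin k) (lookup (a ∷ x))) (sumOver-lookup x)))

allFin-suc : ∀ n → allFin (suc n) ≡ zero ∷ List.map suc (allFin n)
allFin-suc n = cong (zero ∷_) (sym (map-tabulate (λ i → i) suc))

sumOver-Edges : ∀ n (f : Fin n × Fin n → Bool) →
  sumOver (Edges n) f ≡ sumOver (allFin n) (λ j → sumOver (filter (_<? j) (allFin n)) (λ i → f (i , j)))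
sumOver-Edges n f = trans (sumOver-concatMap row (allFin n) f)
                          (sumOver-cong (allFin n) (λ j → sumOver-map (_, j) (filter (_<? j) (allFin n)) f))
  where
  row : Fin n → List (Fin n × Fin n)
  row j = List.map (_, j) (filter (_<? j) (allFin n))

filter-<zero : (is : List (Fin (suc n))) → filter (_<? zero {n}) is ≡ []
filter-<zero []       = refl
filter-<zero (i ∷ is) = filter-<zero is

filter-<suc : (j : Fin n) (is : List (Fin n)) →
  filter (_<? suc j) (List.map suc is) ≡ List.map suc (filter (_<? j) is)
filter-<suc j []       = refl
filter-<suc j (i ∷ is) with does (i <? j)
... | true  = cong (suc i ∷_) (filter-<suc j is)
... | false = filter-<suc j is

sumOver-Edges-suc : ∀ n (f : Fin (suc n) × Fin (suc n) → Bool) →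
  sumOver (Edges (suc n)) f ≡
  sumOver (allFin n) (λ j → f (zero , suc j)) xor sumOver (Edges n) (f ∘ Product.map suc suc)
sumOver-Edges-suc n f = begin
  sumOver (Edges (suc n)) f
    ≡⟨ sumOver-Edges (suc n) f ⟩
  sumOver (allFin (suc n)) column
    ≡⟨ cong (λ js → sumOver js column) (allFin-suc n) ⟩
  column zero xor sumOver (List.map suc (allFin n)) column
    ≡⟨ cong₂ _xor_ column-zero (sumOver-map suc (allFin n) column) ⟩
  sumOver (allFin n) (column ∘ suc)
    ≡⟨ sumOver-cong (allFin n) column-suc ⟩
  sumOver (allFin n) (λ j → f (zero , suc j) xor column′ j)
    ≡⟨ sumOver-xor (allFin n) (λ j → f (zero , suc j)) column′ ⟩
  row₀ xor sumOver (allFin n) column′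
    ≡⟨ cong (row₀ xor_) (sumOver-Edges n (f ∘ Product.map suc suc)) ⟨
  row₀ xor sumOver (Edges n) (f ∘ Product.map suc suc)
    ∎
  where
  open ≡-Reasoning
  row₀ : Bool
  row₀ = sumOver (allFin n) (λ j → f (zero , suc j))
  column : Fin (suc n) → Bool
  column j = sumOver (filter (_<? j) (allFin (suc n))) (λ i → f (i , j))
  column′ : Fin n → Bool
  column′ j = sumOver (filter (_<? j) (allFin n)) (λ i → f (suc i , suc j))
  column-zero : column zero ≡ false
  column-zero = cong (λ is → sumOver is (λ i → f (i , zero))) (filter-<zero (allFin (suc n)))
  column-suc : ∀ j → column (suc j) ≡ f (zero , suc j) xor column′ j
  column-suc j = begin
    column (suc j)
      ≡⟨ cong (λ is → sumOver (filter (_<? suc j) is) (λ i → f (i , suc j))) (allFin-suc n) ⟩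
    f (zero , suc j) xor sumOver (filter (_<? suc j) (List.map suc (allFin n))) (λ i → f (i , suc j))
      ≡⟨ cong (λ is → f (zero , suc j) xor sumOver is (λ i → f (i , suc j))) (filter-<suc j (allFin n)) ⟩
    f (zero , suc j) xor sumOver (List.map suc (filter (_<? j) (allFin n))) (λ i → f (i , suc j))
      ≡⟨ cong (f (zero , suc j) xor_) (sumOver-map suc (filter (_<? j) (allFin n)) (λ i → f (i , suc j))) ⟩
    f (zero , suc j) xor column′ j
      ∎

-- Only the entries w i j with i < j are read.
EdgeWeights : ℕ → Set
EdgeWeights n = Fin n → Fin n → Bool

functional : EdgeWeights n → Bits (N n)
functional {n} w = map (uncurry w) (fromList (Edges n))

quadForm : EdgeWeights n → Bits n → Bool
quadForm w x = functional w · edges (clique x)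

·-fromList : ∀ (f g : X → Bool) as →
             map f (fromList as) · map g (fromList as) ≡ sumOver as (λ a → f a ∧ g a)
·-fromList f g []       = refl
·-fromList f g (a ∷ as) = cong (f a ∧ g a xor_) (·-fromList f g as)

quadForm-sum : ∀ (w : EdgeWeights n) x →
  quadForm w x ≡ sumOver (Edges n) (λ e → uncurry w e ∧ (lookup x (proj₁ e) ∧ lookup x (proj₂ e)))
quadForm-sum {n} w x = ·-fromList _ _ (Edges n)

quadForm-∷ : ∀ (w : EdgeWeights (suc n)) x₀ x →
  quadForm w (x₀ ∷ x) ≡
  sumOver (allFin n) (λ j → w zero (suc j) ∧ (x₀ ∧ lookup x j)) xor quadForm (λ i j → w (suc i) (suc j)) x
quadForm-∷ {n} w x₀ x =
  trans (quadForm-sum w (x₀ ∷ x))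
        (trans (sumOver-Edges-suc n _)
               (cong (sumOver (allFin n) (λ j → w zero (suc j) ∧ (x₀ ∧ lookup x j)) xor_)
                     (sym (quadForm-sum (λ i j → w (suc i) (suc j)) x))))

quadForm-false : (x : Bits n) → quadForm (λ _ _ → false) x ≡ false
quadForm-false {n} x = trans (quadForm-sum (λ _ _ → false) x) (sumOver-false (Edges n))

shift : EdgeWeights n → EdgeWeights (suc (suc n))
shift w (suc (suc i)) (suc (suc j)) = w i j
shift w _             _             = false

quadForm-shift : ∀ (w : EdgeWeights n) x₀ x₁ x → quadForm (shift w) (x₀ ∷ x₁ ∷ x) ≡ quadForm w x
quadForm-shift {n} w x₀ x₁ x = begin
  quadForm (shift w) (x₀ ∷ x₁ ∷ x)
    ≡⟨ quadForm-∷ (shift w) x₀ (x₁ ∷ x) ⟩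
  sumOver (allFin (suc n)) (const false) xor quadForm (λ i j → shift w (suc i) (suc j)) (x₁ ∷ x)
    ≡⟨ cong₂ _xor_ (sumOver-false (allFin (suc n))) (quadForm-∷ (λ i j → shift w (suc i) (suc j)) x₁ x) ⟩
  sumOver (allFin n) (const false) xor quadForm w x
    ≡⟨ cong (_xor quadForm w x) (sumOver-false (allFin n)) ⟩
  quadForm w x
    ∎
  where open ≡-Reasoning

pairWeights : EdgeWeights (suc (suc n))
pairWeights zero       _ = true
pairWeights (suc zero) _ = true
pairWeights _          _ = false

quadForm-pairWeights : ∀ x₀ x₁ (x : Bits n) →
  quadForm pairWeights (x₀ ∷ x₁ ∷ x) ≡ (x₀ ∧ (x₁ xor parity x)) xor (x₁ ∧ parity x)
quadForm-pairWeights {n} x₀ x₁ x = begin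
  quadForm pairWeights (x₀ ∷ x₁ ∷ x)
    ≡⟨ quadForm-∷ pairWeights x₀ (x₁ ∷ x) ⟩
  sumOver (allFin (suc n)) (λ j → x₀ ∧ lookup (x₁ ∷ x) j) xor
  quadForm (λ i j → pairWeights (suc i) (suc j)) (x₁ ∷ x)
    ≡⟨ cong₂ _xor_ (sumOver-∧-lookup x₀ (x₁ ∷ x)) (quadForm-∷ (λ i j → pairWeights (suc i) (suc j)) x₁ x) ⟩
  (x₀ ∧ (x₁ xor parity x)) xor (sumOver (allFin n) (λ j → x₁ ∧ lookup x j) xor quadForm (λ _ _ → false) x)
    ≡⟨ cong ((x₀ ∧ (x₁ xor parity x)) xor_) (cong₂ _xor_ (sumOver-∧-lookup x₁ x) (quadForm-false x)) ⟩
  (x₀ ∧ (x₁ xor parity x)) xor ((x₁ ∧ parity x) xor false)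
    ≡⟨ cong ((x₀ ∧ (x₁ xor parity x)) xor_) (xor-identityʳ (x₁ ∧ parity x)) ⟩
  (x₀ ∧ (x₁ xor parity x)) xor (x₁ ∧ parity x)
    ∎
  where
  open ≡-Reasoning
  sumOver-∧-lookup : ∀ {k} c (y : Bits k) → sumOver (allFin k) (λ j → c ∧ lookup y j) ≡ c ∧ parity y
  sumOver-∧-lookup {k} c y = trans (sumOver-∧ (allFin k) c (lookup y)) (cong (c ∧_) (sumOver-lookup y))

pairWeightsList : ∀ n → Vec (EdgeWeights n) ⌊ n /2⌋
pairWeightsList zero          = []
pairWeightsList (suc zero)    = []
pairWeightsList (suc (suc n)) = pairWeights ∷ map shift (pairWeightsList n)

annihilates-shift : ∀ {m} (ws : Vec (EdgeWeights n) m) x₀ x₁ (x : Bits n) →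
  annihilates (map functional (map shift ws)) (edges (clique (x₀ ∷ x₁ ∷ x))) ≡
  annihilates (map functional ws) (edges (clique x))
annihilates-shift []       x₀ x₁ x = refl
annihilates-shift (w ∷ ws) x₀ x₁ x =
  cong₂ (λ a b → not a ∧ b) (quadForm-shift w x₀ x₁ x) (annihilates-shift ws x₀ x₁ x)

pairWeightsList-triangular : ∀ n → Triangular (edges ∘ clique {n}) (map functional (pairWeightsList n))
pairWeightsList-triangular zero          = _
pairWeightsList-triangular (suc zero)    = _
pairWeightsList-triangular (suc (suc n)) =
  ((true ∷ true ∷ 0ᵥ) , pair∈Ann , pair≡1) ,
  shift-triangular (pairWeightsList n) (pairWeightsList-triangular n)
  where
  Fs : Vec (Bits (N n)) ⌊ n /2⌋
  Fs = map functional (pairWeightsList n)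
  pair∈Ann : Ann (map functional (map shift (pairWeightsList n))) (clique (true ∷ true ∷ 0ᵥ {n}))
  pair∈Ann = trans (annihilates-shift (pairWeightsList n) true true 0ᵥ)
                   (trans (cong (annihilates Fs) edges-clique-0ᵥ) (annihilates-0ᵥ Fs))
  pair≡1 : quadForm (pairWeights {n}) (true ∷ true ∷ 0ᵥ) ≡ true
  pair≡1 = trans (quadForm-pairWeights {n} true true 0ᵥ) (cong (λ p → not p xor p) (parity-0ᵥ {n}))
  shift-triangular : ∀ {m} (ws : Vec (EdgeWeights n) m) →
                     Triangular (edges ∘ clique {n}) (map functional ws) →
                     Triangular (edges ∘ clique {suc (suc n)}) (map functional (map shift ws))
  shift-triangular []       _                            = _
  shift-triangular (w ∷ ws) ((x , x∈Ann , w·x≡1) , tri) =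
    ( (false ∷ false ∷ x)
    , trans (annihilates-shift ws false false x) x∈Ann
    , trans (quadForm-shift w false false x) w·x≡1)
    , shift-triangular ws tri

pairWeightsList-kernel : ∀ n (x : Bits n) → Ann (map functional (pairWeightsList n)) (clique x) → ∣ x ∣ ≤ 1
pairWeightsList-kernel zero          []            _   = z≤n
pairWeightsList-kernel (suc zero)    x             _   = ∣p∣≤n x
pairWeightsList-kernel (suc (suc n)) (x₀ ∷ x₁ ∷ x) ann =
  let (pair≡0 , rest) = annihilates-∷⁻ (functional (pairWeights {n})) (map functional (map shift ws)) ann
  in pair-step x₀ x₁ (pairWeightsList-kernel n x (trans (sym (annihilates-shift ws x₀ x₁ x)) rest))
                     (trans (sym (quadForm-pairWeights x₀ x₁ x)) pair≡0)
  where
  ws : Vec (EdgeWeights n) ⌊ n /2⌋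
  ws = pairWeightsList n
  one-vertex : parity x ≡ false → ∣ x ∣ ≤ 1 → suc ∣ x ∣ ≤ 1
  one-vertex even w = s≤s (≤-reflexive (trans (cong ∣_∣ (even-weight≤1⇒0ᵥ x w even)) (∣⊥∣≡0 n)))
  pair-step : ∀ x₀ x₁ → ∣ x ∣ ≤ 1 → (x₀ ∧ (x₁ xor parity x)) xor (x₁ ∧ parity x) ≡ false →
              ∣ x₀ ∷ x₁ ∷ x ∣ ≤ 1
  pair-step false false w _ = w
  pair-step true  false w q = one-vertex (trans (sym (xor-identityʳ (parity x))) q) w
  pair-step false true  w q = one-vertex q w
  pair-step true  true  w q with parity x
  pair-step true  true  w () | false
  pair-step true  true  w () | true

⌊n/2⌋≡n/2 : ∀ n → ⌊ n /2⌋ ≡ n / 2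
⌊n/2⌋≡n/2 zero          = refl
⌊n/2⌋≡n/2 (suc zero)    = refl
⌊n/2⌋≡n/2 (suc (suc n)) =
  trans (cong suc (⌊n/2⌋≡n/2 n)) (sym (m/n≡1+[m∸n]/n {suc (suc n)} {2} (s≤s (s≤s z≤n))))

codim-upper-bound : ∀ n → Σ (Graph n → Set) (λ L → IsLinearSpace L × CliqueFree L × HasCodim L (n / 2))
codim-upper-bound n =
  let (d , d+m≡N , B , ind , sub , sup) = kernel-basis Fs (pairWeightsList-triangular n)
  in Ann Fs , linear , clique-free , d , (B , sub ∘ lookup∈Span B , ind , λ _ → sup) ,
     subst (λ m → d + m ≡ N n) (⌊n/2⌋≡n/2 n) d+m≡N
  where
  Fs : Vec (Bits (N n)) ⌊ n /2⌋
  Fs = map functional (pairWeightsList n)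
  linear : IsLinearSpace (Ann Fs)
  linear = record { has-zero = annihilates-0ᵥ Fs ; closed-⊕ = λ _ _ → annihilates-+ᵥ Fs }
  clique-free : CliqueFree (Ann Fs)
  clique-free A 2≤∣A∣ A∈Ann =
    contradiction (≤-trans 2≤∣A∣ (pairWeightsList-kernel n A A∈Ann)) λ { (s≤s ()) }

theorem1p6 : (n : ℕ) → 2 ≤ n →
    (Σ (Graph n → Set) (λ L → IsLinearSpace L × CliqueFree L × HasCodim L (n / 2)))
    × ((L : Graph n → Set) → IsLinearSpace L → CliqueFree L →
    (m : ℕ) → HasCodim L m → n / 2 ≤ m)
theorem1p6 n _ = codim-upper-bound n , codim-lower-bound
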